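{- Let $(S,A,\to)$ be any labelled transition system, and consider its projection closure. For every state $s$ of the projection closure and every $\varphi\in{\it HML}_{\it FDP}$: $s\models\varphi$ if and only if $\pi_n(s)\models\varphi$ for all natural numbers $n\geq d(\varphi)$.
   Context: A labelled transition system consists of a set $S$ of states, a set $A$ of actions and transitions $s\xrightarrow{a}s'$. For each $n\in\mathbb{N}$ there is a projection operator $\pi_n$; the projection closure of the LTS has as states all expressions obtained from states of $S$ by finitely many applications of the operators $\pi_n$, with the original transitions together with the transitions given by the rule: if $x\xrightarrow{a}x'$ then $\pi_{n+1}(x)\xrightarrow{a}\pi_n(x')$ (and these are the only transitions of projected states; in particular $\pi_0(x)$ has no outgoing transitions). Hennessy-Milner logic ${\it HML}$ has formulas $\varphi ::= {\sf T} \mid \bigwedge_{i\in I}\varphi_i \mid \langle a\rangle\varphi \mid \neg\varphi$ ($a\in A$, $I$ arbitrary index set), with $s\models{\sf T}$; $s\models\bigwedge_{i\in I}\varphi_i$ iff $s\models\varphi_i$ for all $i$; $s\models\langle a\rangle\varphi$ iff some $s'$ with $s\xrightarrow{a}s'$ satisfies $\varphi$; $s\models\neg\varphi$ iff $s\not\models\varphi$. The depth is $d({\sf T})=0$, $d(\bigwedge_{i\in I}\varphi_i)=\sup\{d(\varphi_i)\mid i\in I\}$, $d(\langle a\rangle\varphi)=1+d(\varphi)$, $d(\neg\varphi)=d(\varphi)$, with values in $\mathbb{N}\cup\{\infty\}$; ${\it HML}_{\it FDP}=\{\varphi\in{\it HML}\mid d(\varphi)<\infty\}$. -}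

module Defs where

open import Data.Nat using (ℕ; zero; suc)
open import Data.Product using (Σ; _×_; ∃)
open import Relation.Nullary using (¬_)
open import Function.Bundles using (_⇔_)

record LTS : Set₁ where
  field
    State  : Set
    Action : Set
    _⟶[_]_ : State → Action → State → Set

module _ (L : LTS) where
  open LTS L

  data PState : Set where
    ⌜_⌝ : State → PState
    π   : ℕ → PState → PState

  data _⇒[_]_ : PState → Action → PState → Set where
    orig : ∀ {s a s'} → s ⟶[ a ] s' → ⌜ s ⌝ ⇒[ a ] ⌜ s' ⌝
    proj : ∀ {n x a x'} → x ⇒[ a ] x' → π (suc n) x ⇒[ a ] π n x'

  data HML : Set₁ where
    T   : HML
    ⋀   : (I : Set) → (I → HML) → HML
    ⟨_⟩_ : Action → HML → HML
    ¬'  : HML → HML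

  _⊨_ : PState → HML → Set
  s ⊨ T        = Data.Unit.⊤ where import Data.Unit
  s ⊨ ⋀ I φs   = (i : I) → s ⊨ φs i
  s ⊨ (⟨ a ⟩ φ) = Σ PState (λ s' → (s ⇒[ a ] s') × (s' ⊨ φ))
  s ⊨ ¬' φ     = ¬ (s ⊨ φ)

  -- d(φ) ≤ n, the unfolding of the depth (valued in ℕ ∪ {∞}, with
  -- sup for conjunctions) being at most the natural number n.
  data _≤d_ : HML → ℕ → Set₁ where
    T≤   : ∀ {n} → T ≤d n
    ⋀≤   : ∀ {n I φs} → ((i : I) → φs i ≤d n) → ⋀ I φs ≤d n
    ⟨⟩≤  : ∀ {n a φ} → φ ≤d n → (⟨ a ⟩ φ) ≤d suc n
    ¬≤   : ∀ {n φ} → φ ≤d n → ¬' φ ≤d n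

  FDP : HML → Set₁
  FDP φ = Σ ℕ (λ n → φ ≤d n)

module Submission where

-- If d(φ) ≤ n then the projection π n does not change the
-- truth of φ at any state of the projection closure:
--   s ⊨ φ  ⇔  π n s ⊨ φ.  The only
-- interesting case is a diamond ⟨a⟩φ with d(φ) ≤ n: the a-successors of
-- π (n+1) s are exactly the states π n s' with s -a-> s' (the projection
-- rule, and its inversion), so the induction hypothesis for φ at depth n
-- transports a witness in either direction.
--
-- The theorem lemma6 follows at once: the forward direction applies the
-- invariance at every n ≥ d(φ); the backward direction applies it at the
-- bound witnessing that φ has finite depth.

open import Defs
open import Data.Nat using (ℕ; suc)
open import Data.Product using (Σ; _×_; _,_)
open import Function.Bundles using (_⇔_; mk⇔; Equivalence)
open import Relation.Binary.PropositionalEquality using (_≡_; refl)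

module Projection (L : LTS) where
  open Equivalence using (to; from)

  projection-successor : ∀ {n s a t} → _⇒[_]_ L (π (suc n) s) a t →
                         Σ (PState L) λ s' → _⇒[_]_ L s a s' × t ≡ π n s'
  projection-successor (proj {x' = s'} step) = s' , step , refl

  projection-invariant : ∀ {n} (φ : HML L) → _≤d_ L φ n → (s : PState L) →
                         _⊨_ L s φ ⇔ _⊨_ L (π n s) φ
  projection-invariant T T≤ s = mk⇔ (λ h → h) (λ h → h)
  projection-invariant (⋀ I φs) (⋀≤ bounds) s = mk⇔
    (λ h i → to   (projection-invariant (φs i) (bounds i) s) (h i))
    (λ h i → from (projection-invariant (φs i) (bounds i) s) (h i))
  projection-invariant {suc n} (⟨ a ⟩ φ) (⟨⟩≤ bound) s = mk⇔ forward backward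
    where
      forward : _⊨_ L s (⟨ a ⟩ φ) → _⊨_ L (π (suc n) s) (⟨ a ⟩ φ)
      forward (s' , step , h) =
        π n s' , proj step , to (projection-invariant φ bound s') h

      backward : _⊨_ L (π (suc n) s) (⟨ a ⟩ φ) → _⊨_ L s (⟨ a ⟩ φ)
      backward (t , step , h) with projection-successor step
      ... | s' , step' , refl =
        s' , step' , from (projection-invariant φ bound s') h
  projection-invariant (¬' φ) (¬≤ bound) s = mk⇔
    (λ ¬h h → ¬h (from (projection-invariant φ bound s) h))
    (λ ¬h h → ¬h (to   (projection-invariant φ bound s) h))

open Projection using (projection-invariant)

lemma6 : (L : LTS) (s : PState L) (φ : HML L) → FDP L φ →
    (_⊨_ L s φ ⇔ ((n : ℕ) → _≤d_ L φ n → _⊨_ L (π n s) φ))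
lemma6 L s φ (d , φ≤d) = mk⇔
  (λ h n φ≤n → Equivalence.to (projection-invariant L φ φ≤n s) h)
  (λ h → Equivalence.from (projection-invariant L φ φ≤d s) (h d φ≤d))
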